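{- Let $k\ge 4$ be an integer and $G$ a finite simple graph. If $G$ admits an $\mathcal{H}_k$-free circular ordering, then $G$ admits a $\mathcal{PH}_k$-free linear ordering.
   Context: A circular ordering of a finite set $X$ is a ternary relation $C\subseteq X^3$ such that for all $x,y,z,w\in X$: $(x,y,z)\in C\Rightarrow(y,z,x)\in C$; $(x,y,z)\in C\Rightarrow(x,z,y)\notin C$; $(x,y,z),(x,z,w)\in C\Rightarrow(x,y,w)\in C$; and for distinct $x,y,z$ either $(x,y,z)\in C$ or $(x,z,y)\in C$. Circularly ordered graphs $(G,C)$, induced circularly ordered subgraphs (induced subgraph with restricted relation) and isomorphisms (graph isomorphisms preserving the relation) are defined naturally. For $n\ge2$, write $SP_n\to(G,C)$ if there exist vertices $u_1,\dots,u_n$ with $u_iu_{i+1}\in E(G)$ for $1\le i\le n-1$, $u_1,\dots,u_{n-1}$ pairwise distinct with $(u_1,u_i,u_j)\in C$ whenever $1<i<j\le n-1$, and either $u_n=u_1$ or ($u_n\notin\{u_1,\dots,u_{n-1}\}$ and $(u_{n-1},u_n,u_1)\in C$). $\mathcal{H}_n$ is the set (up to isomorphism) of circularly ordered graphs $X$ with $SP_n\to X$ but $SP_n\not\to Y$ for every proper induced circularly ordered subgraph $Y$ of $X$; a circular ordering is $\mathcal{H}_n$-free if no induced circularly ordered subgraph is isomorphic to a member of $\mathcal{H}_n$. Linearly ordered graphs: for $m\ge3$, $St_m$ is the path $v_1\cdots v_m$ with $v_1<\dots<v_m$; $sSt_m$ is the path $v_1\cdots v_m$ with $v_m<v_1<\dots<v_{m-1}$;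 $StC_m$ is the cycle $v_1\cdots v_mv_1$ with $v_1<\dots<v_m$. For $m\ge4$, $\mathcal{PH}_m$ is the set of linearly ordered graphs obtained from one of $St_m,sSt_m,StC_m,StC_{m-1}$ by adding edges (same vertices, same order). A linear ordering of $V(G)$ is $\mathcal{PH}_m$-free if no induced subgraph with the restricted order is order-isomorphic to a member of $\mathcal{PH}_m$. -}

module Defs where

open import Data.Nat using (ℕ; zero; suc; _<_; _≤_; _∸_)
open import Data.Fin using (Fin)
open import Data.Bool using (Bool; true; false)
open import Data.Product using (Σ; ∃; _×_; _,_)
open import Data.Sum using (_⊎_)
open import Relation.Nullary using (¬_)
open import Relation.Binary.PropositionalEquality using (_≡_; _≢_)

record SimpleGraph (N : ℕ) : Set where
  field
    adj    : Fin N → Fin N → Bool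
    sym    : ∀ u v → adj u v ≡ adj v u
    irrefl : ∀ v → adj v v ≡ false
open SimpleGraph public

record CircularOrdering (N : ℕ) : Set where
  field
    C     : Fin N → Fin N → Fin N → Bool
    cyc   : ∀ x y z → C x y z ≡ true → C y z x ≡ true
    asym  : ∀ x y z → C x y z ≡ true → C x z y ≡ false
    trans : ∀ x y z w → C x y z ≡ true → C x z w ≡ true → C x y w ≡ true
    total : ∀ x y z → x ≢ y → y ≢ z → x ≢ z → C x y z ≡ true ⊎ C x z y ≡ true
open CircularOrdering public

record LinearOrdering (N : ℕ) : Set where
  field
    lt      : Fin N → Fin N → Bool
    irrefl  : ∀ x → lt x x ≡ false
    trans   : ∀ x y z → lt x y ≡ true → lt y z ≡ true → lt x z ≡ true
    total   : ∀ x y → x ≢ y → lt x y ≡ true ⊎ lt y x ≡ true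
open LinearOrdering public

-- Vertex subsets (induced subgraphs are given by their vertex set)

VSet : ℕ → Set
VSet N = Fin N → Bool

_⊊_ : ∀ {N} → VSet N → VSet N → Set
S' ⊊ S = (∀ v → S' v ≡ true → S v ≡ true) × ∃ λ v → S v ≡ true × S' v ≡ false

-- SP_n → (G[S], C|S): the circularly ordered graph induced on S admits
-- the pattern SP_n.  Vertices u_1,…,u_n are u 0,…,u (n ∸ 1).

SPinto : ∀ {N} → ℕ → SimpleGraph N → CircularOrdering N → VSet N → Set
SPinto {N} n G Co S = ∃ λ (u : ℕ → Fin N) →
    (∀ i → i < n → S (u i) ≡ true)
  × (∀ i → suc i < n → adj G (u i) (u (suc i)) ≡ true)
  × (∀ i j → i < j → suc j < n → u i ≢ u j)
  × (∀ i j → 0 < i → i < j → suc j < n → C Co (u 0) (u i) (u j) ≡ true)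
  × ( u (n ∸ 1) ≡ u 0
    ⊎ ( (∀ i → suc i < n → u (n ∸ 1) ≢ u i)
      × C Co (u (n ∸ 2)) (u (n ∸ 1)) (u 0) ≡ true))

-- The induced circularly ordered subgraph on S is (isomorphic to) a
-- member of H_n: SP_n maps into it but into no proper induced
-- circularly ordered subgraph of it.
InducedHn : ∀ {N} → ℕ → SimpleGraph N → CircularOrdering N → VSet N → Set
InducedHn n G Co S = SPinto n G Co S × (∀ S' → S' ⊊ S → ¬ SPinto n G Co S')

HFree : ∀ {N} → ℕ → SimpleGraph N → CircularOrdering N → Set
HFree n G Co = ∀ S → ¬ InducedHn n G Co S

Increasing : ∀ {N} → LinearOrdering N → ℕ → (ℕ → Fin N) → Set
Increasing L len x = ∀ i j → i < j → j < len → lt L (x i) (x j) ≡ true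

-- St_m (plus possibly more edges): x0 < … < x(m-1), path x0 x1 … x(m-1)
StOcc : ∀ {N} → SimpleGraph N → LinearOrdering N → ℕ → Set
StOcc {N} G L m = ∃ λ (x : ℕ → Fin N) → Increasing L m x
  × (∀ i → suc i < m → adj G (x i) (x (suc i)) ≡ true)

-- sSt_m: path v1 … vm with vm < v1 < … < v(m-1); sorted x0 = vm,
-- x i = v i (1 ≤ i ≤ m-1): edges x i x(i+1) for 1 ≤ i ≤ m-2, and x(m-1) x0
sStOcc : ∀ {N} → SimpleGraph N → LinearOrdering N → ℕ → Set
sStOcc {N} G L m = ∃ λ (x : ℕ → Fin N) → Increasing L m x
  × (∀ i → 0 < i → suc i < m → adj G (x i) (x (suc i)) ≡ true)
  × adj G (x (m ∸ 1)) (x 0) ≡ true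

StCOcc : ∀ {N} → SimpleGraph N → LinearOrdering N → ℕ → Set
StCOcc {N} G L len = ∃ λ (x : ℕ → Fin N) → Increasing L len x
  × (∀ i → suc i < len → adj G (x i) (x (suc i)) ≡ true)
  × adj G (x (len ∸ 1)) (x 0) ≡ true

PHOcc : ∀ {N} → SimpleGraph N → LinearOrdering N → ℕ → Set
PHOcc G L m = StOcc G L m ⊎ sStOcc G L m ⊎ StCOcc G L m ⊎ StCOcc G L (m ∸ 1)

PHFree : ∀ {N} → ℕ → SimpleGraph N → LinearOrdering N → Set
PHFree m G L = ¬ PHOcc G L m

-- Cutting the circular ordering at a vertex gives a linear ordering in which
-- every increasing triple is positively oriented.  An ordered St_k, sSt_k,
-- StC_k or StC_(k-1) then yields SP_k in the whole circularly ordered graph: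
-- its first k-1 vertices increase, hence are circularly ordered from the
-- first one, and the last vertex either closes the walk or lies outside the
-- arc they span.  As strict inclusion of vertex sets is well-founded, a
-- vertex set admitting SP_k contains a minimal one, which is a member of H_k.
module Submission where

open import Defs
open import Data.Nat using (ℕ; zero; suc; _+_; _<_; _≤_; z≤n; s≤s; _<?_)
open import Data.Nat.Properties
  using (≤-refl; ≤-pred; <-trans; <⇒≤; <-irrefl; m<n⇒m<1+n; m<1+n⇒m<n∨m≡n)
open import Data.Nat.Induction using (<-wellFounded)
open import Data.Fin using (Fin; zero; suc)
open import Data.Fin.Subset using (_∈_; _∉_; _⊂_; ∣_∣)
open import Data.Fin.Subset.Properties using (p⊂q⇒∣p∣<∣q∣)
open import Data.Vec using (tabulate)
open import Data.Vec.Properties using (lookup⇒[]=; []=⇒lookup; lookup∘tabulate)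
open import Data.Bool using (Bool; true; false)
open import Data.Product using (∃; _,_; _×_)
open import Data.Sum using (_⊎_; inj₁; inj₂)
open import Data.Empty using (⊥; ⊥-elim)
open import Function using (_∘_)
open import Induction.WellFounded using (WellFounded; Acc; acc; module Subrelation)
import Relation.Binary.Construct.On as On
open import Relation.Nullary using (¬_; yes; no)
open import Relation.Binary.PropositionalEquality
  using (_≡_; _≢_; refl; subst₂) renaming (sym to ≡-sym; trans to ≡-trans)

∈-tabulate : ∀ {N} {S : VSet N} {v} → S v ≡ true → v ∈ tabulate S
∈-tabulate {S = S} {v} Sv = lookup⇒[]= v (tabulate S) (≡-trans (lookup∘tabulate S v) Sv)

∈-tabulate⁻ : ∀ {N} {S : VSet N} {v} → v ∈ tabulate S → S v ≡ true
∈-tabulate⁻ {S = S} {v} v∈S = ≡-trans (≡-sym (lookup∘tabulate S v)) ([]=⇒lookup v∈S)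

∉-tabulate : ∀ {N} {S : VSet N} {v} → S v ≡ false → v ∉ tabulate S
∉-tabulate Sv v∈S with () ← ≡-trans (≡-sym Sv) (∈-tabulate⁻ v∈S)

tabulate-⊂ : ∀ {N} {S' S : VSet N} → S' ⊊ S → tabulate S' ⊂ tabulate S
tabulate-⊂ (S'⊆S , v , Sv , S'v) =
  (∈-tabulate ∘ S'⊆S _ ∘ ∈-tabulate⁻) , v , ∈-tabulate Sv , ∉-tabulate S'v

⊊-wellFounded : ∀ {N} → WellFounded (_⊊_ {N})
⊊-wellFounded =
  Subrelation.wellFounded (p⊂q⇒∣p∣<∣q∣ ∘ tabulate-⊂)
    (On.wellFounded (∣_∣ ∘ tabulate) <-wellFounded)

HFree⇒¬SPinto : ∀ {N n} {G : SimpleGraph N} {Co : CircularOrdering N}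
  → HFree n G Co → ∀ S → ¬ SPinto n G Co S
HFree⇒¬SPinto {n = n} {G} {Co} hfree S = go (⊊-wellFounded S)
  where
  go : ∀ {S} → Acc _⊊_ S → ¬ SPinto n G Co S
  go {S} (acc rs) sp = hfree S (sp , λ S' S'⊊S → go (rs S'⊊S))

module _ {N} (Co : CircularOrdering N) where

  C-degenerate : ∀ x y → C Co x y y ≡ false
  C-degenerate x y with C Co x y y in Cxyy
  ... | false = refl
  ... | true = ≡-trans (≡-sym Cxyy) (asym Co x y y Cxyy)

  C-antisym : ∀ {x y z} → C Co x y z ≡ true → C Co x z y ≡ true → ⊥
  C-antisym {x} {y} {z} Cxyz Cxzy with () ← ≡-trans (≡-sym Cxzy) (asym Co x y z Cxyz)

  C⇒≢ : ∀ {x y z} → C Co x y z ≡ true → y ≢ z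
  C⇒≢ Cxyy refl = C-antisym Cxyy Cxyy

  C-rebase : ∀ {a x y z} → C Co a x y ≡ true → C Co a y z ≡ true → C Co x y z ≡ true
  C-rebase {x = x} {y} {z} Caxy Cayz
    with total Co x y z (C⇒≢ Caxy) (C⇒≢ Cayz) (C⇒≢ (CircularOrdering.trans Co _ _ _ _ Caxy Cayz))
  ... | inj₁ Cxyz = Cxyz
  ... | inj₂ Cxzy = ⊥-elim (C-antisym Cyzx Cyxz)
    where
    Cyxz : C Co y x z ≡ true
    Cyxz = cyc Co _ _ _ (cyc Co _ _ _ Cxzy)
    Cyzx : C Co y z x ≡ true
    Cyzx = CircularOrdering.trans Co _ _ _ _ (cyc Co _ _ _ Cayz) (cyc Co _ _ _ (cyc Co _ _ _ Caxy))

record IsCutOf {N} (L : LinearOrdering N) (Co : CircularOrdering N) : Set where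
  field
    oriented : ∀ x y z → lt L x y ≡ true → lt L y z ≡ true → C Co x y z ≡ true
open IsCutOf public

module CutAtZero {M} (Co : CircularOrdering (suc M)) where

  <₀ : Fin (suc M) → Fin (suc M) → Bool
  <₀ zero    zero    = false
  <₀ zero    (suc _) = true
  <₀ (suc _) zero    = false
  <₀ (suc x) (suc y) = C Co zero (suc x) (suc y)

  <₀-irrefl : ∀ x → <₀ x x ≡ false
  <₀-irrefl zero    = refl
  <₀-irrefl (suc x) = C-degenerate Co zero (suc x)

  <₀-trans : ∀ x y z → <₀ x y ≡ true → <₀ y z ≡ true → <₀ x z ≡ true
  <₀-trans zero    (suc y) (suc z) _   _   = refl
  <₀-trans (suc x) (suc y) (suc z) x<y y<z = CircularOrdering.trans Co _ _ _ _ x<y y<z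
  <₀-trans x       (suc y) zero    _   ()
  <₀-trans zero    zero    _       ()  _
  <₀-trans (suc x) zero    _       ()  _

  <₀-total : ∀ x y → x ≢ y → <₀ x y ≡ true ⊎ <₀ y x ≡ true
  <₀-total zero    zero    x≢y = ⊥-elim (x≢y refl)
  <₀-total zero    (suc y) _   = inj₁ refl
  <₀-total (suc x) zero    _   = inj₂ refl
  <₀-total (suc x) (suc y) x≢y = total Co zero (suc x) (suc y) (λ ()) x≢y (λ ())

  linearOrdering : LinearOrdering (suc M)
  linearOrdering = record { lt = <₀ ; irrefl = <₀-irrefl ; trans = <₀-trans ; total = <₀-total }

  <₀-oriented : ∀ x y z → <₀ x y ≡ true → <₀ y z ≡ true → C Co x y z ≡ true
  <₀-oriented zero    (suc y) (suc z) _   y<z = y<z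
  <₀-oriented (suc x) (suc y) (suc z) x<y y<z = C-rebase Co x<y y<z
  <₀-oriented x       (suc y) zero    _   ()
  <₀-oriented zero    zero    _       ()  _
  <₀-oriented (suc x) zero    _       ()  _

  isCut : IsCutOf linearOrdering Co
  isCut = record { oriented = <₀-oriented }

cut : ∀ {N} (Co : CircularOrdering N) → ∃ λ L → IsCutOf L Co
cut {zero}  Co =
    record { lt = λ _ _ → false ; irrefl = λ () ; trans = λ () ; total = λ () }
  , record { oriented = λ () }
cut {suc M} Co = CutAtZero.linearOrdering Co , CutAtZero.isCut Co

snocAt : ∀ {A : Set} → ℕ → (ℕ → A) → A → ℕ → A
snocAt n f y i with i <? n
... | yes _ = f i
... | no  _ = y

snocAt-< : ∀ {A : Set} n (f : ℕ → A) y {i} → i < n → snocAt n f y i ≡ f i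
snocAt-< n f y {i} i<n with i <? n
... | yes _   = refl
... | no  i≮n = ⊥-elim (i≮n i<n)

snocAt-≡ : ∀ {A : Set} n (f : ℕ → A) y → snocAt n f y n ≡ y
snocAt-≡ n f y with n <? n
... | yes n<n = ⊥-elim (<-irrefl refl n<n)
... | no  _   = refl

full : ∀ {N} → VSet N
full _ = true

Increasing-init : ∀ {N} {L : LinearOrdering N} {n f} → Increasing L (suc n) f → Increasing L n f
Increasing-init inc i j i<j j<n = inc i j i<j (m<n⇒m<1+n j<n)

module _ {N} (G : SimpleGraph N) {Co : CircularOrdering N} {L : LinearOrdering N}
         (isCut : IsCutOf L Co) where

  private
    _<ᴸ_ : Fin N → Fin N → Set
    x <ᴸ y = lt L x y ≡ true

    Adjacent : Fin N → Fin N → Set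
    Adjacent x y = adj G x y ≡ true

  <ᴸ⇒≢ : ∀ {x y} → x <ᴸ y → x ≢ y
  <ᴸ⇒≢ {x} x<x refl with () ← ≡-trans (≡-sym x<x) (irrefl L x)

  -- y can end an SP_(3+m) whose first 2+m vertices are f 0, …, f (suc m)
  Closes : ℕ → (ℕ → Fin N) → Fin N → Set
  Closes m f y = y ≡ f 0 ⊎ (∀ i → i < 2 + m → y ≢ f i) × C Co (f (suc m)) y (f 0) ≡ true

  module _ {m f} (inc : Increasing L (2 + m) f) where

    closes-above : ∀ {y} → f (suc m) <ᴸ y → Closes m f y
    closes-above {y} top<y =
      inj₂ (fresh , cyc Co _ _ _ (oriented isCut _ _ _ (inc 0 (suc m) (s≤s z≤n) ≤-refl) top<y))
      where
      fresh : ∀ i → i < 2 + m → y ≢ f i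
      fresh i i<2+m with m<1+n⇒m<n∨m≡n i<2+m
      ... | inj₁ i<top  = <ᴸ⇒≢ (LinearOrdering.trans L _ _ _ (inc i (suc m) i<top ≤-refl) top<y) ∘ ≡-sym
      ... | inj₂ refl   = <ᴸ⇒≢ top<y ∘ ≡-sym

    closes-below : ∀ {y} → y <ᴸ f 0 → Closes m f y
    closes-below {y} y<bot =
      inj₂ (fresh , cyc Co _ _ _ (cyc Co _ _ _ (oriented isCut _ _ _ y<bot (inc 0 (suc m) (s≤s z≤n) ≤-refl))))
      where
      fresh : ∀ i → i < 2 + m → y ≢ f i
      fresh zero    _     = <ᴸ⇒≢ y<bot
      fresh (suc i) i<2+m = <ᴸ⇒≢ (LinearOrdering.trans L _ _ _ y<bot (inc 0 (suc i) (s≤s z≤n) i<2+m))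

  SPinto-snoc : ∀ m f y → Increasing L (2 + m) f
    → (∀ i → suc i < 2 + m → adj G (f i) (f (suc i)) ≡ true)
    → adj G (f (suc m)) y ≡ true
    → Closes m f y
    → SPinto (3 + m) G Co full
  SPinto-snoc m f y inc path last closes = u , (λ _ _ → refl) , edges , distinct , cyclic , closed closes
    where
    u : ℕ → Fin N
    u = snocAt (2 + m) f y
    u-< : ∀ {i} → i < 2 + m → u i ≡ f i
    u-< = snocAt-< (2 + m) f y
    u-last : u (2 + m) ≡ y
    u-last = snocAt-≡ (2 + m) f y

    edges : ∀ i → suc i < 3 + m → adj G (u i) (u (suc i)) ≡ true
    edges i si<3+m with m<1+n⇒m<n∨m≡n si<3+m
    ... | inj₁ si<2+m = subst₂ Adjacent (≡-sym (u-< (<⇒≤ si<2+m))) (≡-sym (u-< si<2+m)) (path i si<2+m)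
    ... | inj₂ refl   = subst₂ Adjacent (≡-sym (u-< ≤-refl)) (≡-sym u-last) last

    distinct : ∀ i j → i < j → suc j < 3 + m → u i ≢ u j
    distinct i j i<j sj<3+m rewrite u-< (<-trans i<j (≤-pred sj<3+m)) | u-< (≤-pred sj<3+m) =
      <ᴸ⇒≢ (inc i j i<j (≤-pred sj<3+m))

    cyclic : ∀ i j → 0 < i → i < j → suc j < 3 + m → C Co (u 0) (u i) (u j) ≡ true
    cyclic i j 0<i i<j sj<3+m
      rewrite u-< {0} (s≤s z≤n) | u-< (<-trans i<j (≤-pred sj<3+m)) | u-< (≤-pred sj<3+m) =
      oriented isCut _ _ _ (inc 0 i 0<i (<-trans i<j (≤-pred sj<3+m))) (inc i j i<j (≤-pred sj<3+m))

    closed : Closes m f y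
      → u (2 + m) ≡ u 0 ⊎ (∀ i → suc i < 3 + m → u (2 + m) ≢ u i) × C Co (u (suc m)) (u (2 + m)) (u 0) ≡ true
    closed (inj₁ y≡f0) = inj₁ (≡-trans u-last (≡-trans y≡f0 (≡-sym (u-< (s≤s z≤n)))))
    closed (inj₂ (fresh , Cy)) rewrite u-last | u-< {0} (s≤s z≤n) | u-< {suc m} ≤-refl = inj₂ (fresh′ , Cy)
      where
      fresh′ : ∀ i → suc i < 3 + m → y ≢ u i
      fresh′ i si<3+m rewrite u-< (≤-pred si<3+m) = fresh i (≤-pred si<3+m)

  St⇒SPinto : ∀ m → StOcc G L (3 + m) → SPinto (3 + m) G Co full
  St⇒SPinto m (x , inc , path) =
    SPinto-snoc m x (x (2 + m)) init (λ i → path i ∘ m<n⇒m<1+n) (path (suc m) ≤-refl)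
      (closes-above init (inc (suc m) (2 + m) ≤-refl ≤-refl))
    where
    init : Increasing L (2 + m) x
    init = Increasing-init {L = L} inc

  sSt⇒SPinto : ∀ m → sStOcc G L (3 + m) → SPinto (3 + m) G Co full
  sSt⇒SPinto m (x , inc , path , back) =
    SPinto-snoc m (x ∘ suc) (x 0) inc∘suc (λ i → path (suc i) (s≤s z≤n) ∘ s≤s) back
      (closes-below inc∘suc (inc 0 1 (s≤s z≤n) (s≤s (s≤s z≤n))))
    where
    inc∘suc : Increasing L (2 + m) (x ∘ suc)
    inc∘suc i j i<j j<2+m = inc (suc i) (suc j) (s≤s i<j) (s≤s j<2+m)

  StC⇒SPinto : ∀ m → StCOcc G L (2 + m) → SPinto (3 + m) G Co full
  StC⇒SPinto m (x , inc , path , back) = SPinto-snoc m x (x 0) inc path back (inj₁ refl)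

  PHOcc⇒SPinto : ∀ m → PHOcc G L (3 + m) → SPinto (3 + m) G Co full
  PHOcc⇒SPinto m (inj₁ st)                                 = St⇒SPinto m st
  PHOcc⇒SPinto m (inj₂ (inj₁ sst))                         = sSt⇒SPinto m sst
  PHOcc⇒SPinto m (inj₂ (inj₂ (inj₁ (x , inc , path , _)))) = St⇒SPinto m (x , inc , path)
  PHOcc⇒SPinto m (inj₂ (inj₂ (inj₂ stc)))                  = StC⇒SPinto m stc

mainTheorem13 : (k : ℕ) → 4 ≤ k → {N : ℕ} → (G : SimpleGraph N)
    → (∃ λ (Co : CircularOrdering N) → HFree k G Co)
    → ∃ λ (L : LinearOrdering N) → PHFree k G L
mainTheorem13 .(3 + m) (s≤s (s≤s (s≤s {n = m} _))) G (Co , hfree) with cut Co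
... | L , isCut = L , HFree⇒¬SPinto {G = G} {Co} hfree full ∘ PHOcc⇒SPinto G isCut m
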